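{- The category $\mathrm{R}$ has finite products. It does not have all finite limits.
   Context: The category $\mathrm{R}$ has two objects $\mathbf 1$ and $\mathbf N$; $\mathbf 1$ is terminal, $\mathrm{R}(\mathbf N,\mathbf N)$ is the set of primitive recursive functions $\mathbb N\to\mathbb N$, and $\mathrm{R}(\mathbf 1,\mathbf N)=\mathbb N$, with composition given by composition of functions (a morphism $\mathbf 1\to\mathbf N$ being regarded as a constant). -}

module Defs where

open import Data.Nat using (ℕ; zero; suc)
open import Data.Fin using (Fin)
open import Data.Vec using (Vec; []; _∷_; lookup)
open import Data.Unit using (⊤; tt)
open import Data.Empty using (⊥)
open import Data.Product using (Σ; _,_; proj₁; proj₂)
open import Relation.Binary.PropositionalEquality using (_≡_)

data PR : ℕ → Set where
  Z : PR 0
  S : PR 1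
  P : ∀ {n} → Fin n → PR n
  C : ∀ {m n} → PR m → Vec (PR n) m → PR n
  R : ∀ {n} → PR n → PR (suc (suc n)) → PR (suc n)

mutual
  ⟦_⟧ : ∀ {n} → PR n → Vec ℕ n → ℕ
  ⟦ Z ⟧ xs = 0
  ⟦ S ⟧ (x ∷ []) = suc x
  ⟦ P i ⟧ xs = lookup xs i
  ⟦ C f gs ⟧ xs = ⟦ f ⟧ (⟦ gs ⟧* xs)
  ⟦ R f g ⟧ (zero ∷ xs) = ⟦ f ⟧ xs
  ⟦ R f g ⟧ (suc y ∷ xs) = ⟦ g ⟧ (⟦ R f g ⟧ (y ∷ xs) ∷ y ∷ xs)

  ⟦_⟧* : ∀ {m n} → Vec (PR n) m → Vec ℕ n → Vec ℕ m
  ⟦ [] ⟧* xs = []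
  ⟦ g ∷ gs ⟧* xs = ⟦ g ⟧ xs ∷ ⟦ gs ⟧* xs

IsPrimRec : (ℕ → ℕ) → Set
IsPrimRec f = Σ (PR 1) λ p → ∀ x → ⟦ p ⟧ (x ∷ []) ≡ f x

PRFun : Set
PRFun = Σ (ℕ → ℕ) IsPrimRec

constPR0 : ℕ → PR 0
constPR0 zero = Z
constPR0 (suc c) = C S (constPR0 c ∷ [])

constPR1 : ℕ → PR 1
constPR1 c = C (constPR0 c) []

data Obj : Set where
  𝟏 : Obj
  𝐍 : Obj

Hom : Obj → Obj → Set
Hom 𝟏 𝟏 = ⊤
Hom 𝐍 𝟏 = ⊤
Hom 𝟏 𝐍 = ℕ
Hom 𝐍 𝐍 = PRFun

_≈_ : ∀ {A B} → Hom A B → Hom A B → Set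
_≈_ {𝟏} {𝟏} f g = ⊤
_≈_ {𝐍} {𝟏} f g = ⊤
_≈_ {𝟏} {𝐍} f g = f ≡ g
_≈_ {𝐍} {𝐍} f g = ∀ x → proj₁ f x ≡ proj₁ g x

infixr 9 _∘_
_∘_ : ∀ {A B C} → Hom B C → Hom A B → Hom A C
_∘_ {A} {B} {𝟏} g f = tt-of A
  where
  tt-of : ∀ A → Hom A 𝟏
  tt-of 𝟏 = tt
  tt-of 𝐍 = tt
_∘_ {𝟏} {𝟏} {𝐍} g f = g
_∘_ {𝐍} {𝟏} {𝐍} c f = (λ _ → c) , (constPR1 c , λ x → helper c)
  where
  helper : ∀ c → ⟦ constPR0 c ⟧ [] ≡ c
  helper zero = Relation.Binary.PropositionalEquality.refl
  helper (suc c) = Relation.Binary.PropositionalEquality.cong suc (helper c)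
_∘_ {𝟏} {𝐍} {𝐍} g n = proj₁ g n
_∘_ {𝐍} {𝐍} {𝐍} (g , p , hp) (f , q , hq) =
  (λ x → g (f x)) ,
  (C p (q ∷ []) , λ x →
    Relation.Binary.PropositionalEquality.trans
      (Relation.Binary.PropositionalEquality.cong (λ y → ⟦ p ⟧ (y ∷ [])) (hq x))
      (hp (f x)))

record FinDiagram : Set where
  field
    nV   : ℕ
    nE   : ℕ
    src  : Fin nE → Fin nV
    tgt  : Fin nE → Fin nV
    obj  : Fin nV → Obj
    mor  : (e : Fin nE) → Hom (obj (src e)) (obj (tgt e))

record Cone (D : FinDiagram) (X : Obj) : Set where
  open FinDiagram D
  field
    leg     : (v : Fin nV) → Hom X (obj v)
    commute : (e : Fin nE) → (mor e ∘ leg (src e)) ≈ leg (tgt e)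

record Limit (D : FinDiagram) : Set where
  open FinDiagram D
  field
    apex    : Obj
    cone    : Cone D apex
    mediate : ∀ {X} → Cone D X → Hom X apex
    factor  : ∀ {X} (K : Cone D X) (v : Fin nV) →
              (Cone.leg cone v ∘ mediate K) ≈ Cone.leg K v
    unique  : ∀ {X} (K : Cone D X) (u : Hom X apex) →
              (∀ v → (Cone.leg cone v ∘ u) ≈ Cone.leg K v) → u ≈ mediate K

discrete : (n : ℕ) → (Fin n → Obj) → FinDiagram
discrete n o = record
  { nV = n ; nE = 0 ; src = λ () ; tgt = λ () ; obj = o ; mor = λ () }

HasFiniteProducts : Set
HasFiniteProducts = (n : ℕ) (o : Fin n → Obj) → Limit (discrete n o)

HasFiniteLimits : Set
HasFiniteLimits = (D : FinDiagram) → Limit D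

-- 𝟏 is terminal and a unit for binary products, and 𝐍 × 𝐍 ≅ 𝐍 via the Cantor
-- pairing pair a b = triangle (a + b) + a. Its inverse is primitive recursive
-- because the index of the diagonal through n obeys a primitive recursion: it
-- grows by one exactly when n reaches the next triangular number. A terminal
-- object and binary products give all finite products. Finite limits fail
-- already for 𝐍 with the single endomorphism suc: its limit would be the empty
-- set of fixed points of suc, but both objects of R have a global element, so
-- there is no cone at all.
module Submission where

open import Defs
open import Data.Fin using (Fin; zero; suc)
open import Data.Nat using (ℕ; zero; suc; _+_; _∸_; pred; _≤_; _<_; z≤n; s≤s; z<s; _≤?_; s≤s⁻¹)
open import Data.Nat.Properties
open import Data.Product using (_×_; Σ; _,_; proj₁; proj₂)
open import Data.Unit using (tt)
open import Data.Vec using (Vec; []; _∷_; lookup)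
open import Function using (flip)
open import Relation.Binary.Definitions using (tri<; tri≈; tri>)
open import Relation.Binary.PropositionalEquality
open import Relation.Nullary using (¬_; yes; no; contradiction)

Definable : (n : ℕ) → (Vec ℕ n → ℕ) → Set
Definable n f = Σ (PR n) λ p → ∀ xs → ⟦ p ⟧ xs ≡ f xs

Definable₁ : (ℕ → ℕ) → Set
Definable₁ f = Definable 1 λ xs → f (lookup xs zero)

Definable₂ : (ℕ → ℕ → ℕ) → Set
Definable₂ f = Definable 2 λ xs → f (lookup xs zero) (lookup xs (suc zero))

proj-definable : ∀ {n} (i : Fin n) → Definable n (λ xs → lookup xs i)
proj-definable i = P i , λ _ → refl

constPR0-correct : ∀ c → ⟦ constPR0 c ⟧ [] ≡ c
constPR0-correct zero    = refl
constPR0-correct (suc c) = cong suc (constPR0-correct c)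

const-definable : ∀ {n} c → Definable n (λ _ → c)
const-definable c = C (constPR0 c) [] , λ _ → constPR0-correct c

suc-definable : Definable₁ suc
suc-definable = S , λ { (x ∷ []) → refl }

∘₁-definable : ∀ {n f g} → Definable 1 f → Definable n g → Definable n (λ xs → f (g xs ∷ []))
∘₁-definable (p , ⟦p⟧≡f) (q , ⟦q⟧≡g) =
  C p (q ∷ []) , λ xs → trans (cong (λ y → ⟦ p ⟧ (y ∷ [])) (⟦q⟧≡g xs)) (⟦p⟧≡f _)

∘₂-definable : ∀ {n f g h} → Definable 2 f → Definable n g → Definable n h →
               Definable n (λ xs → f (g xs ∷ h xs ∷ []))
∘₂-definable (p , ⟦p⟧≡f) (q , ⟦q⟧≡g) (r , ⟦r⟧≡h) =
  C p (q ∷ r ∷ []) , λ xs →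
    trans (cong₂ (λ y z → ⟦ p ⟧ (y ∷ z ∷ [])) (⟦q⟧≡g xs) (⟦r⟧≡h xs)) (⟦p⟧≡f _)

rec-definable : ∀ {n f g} → Definable n f → Definable (suc (suc n)) g →
                (h : Vec ℕ (suc n) → ℕ) →
                (∀ xs → h (zero ∷ xs) ≡ f xs) →
                (∀ y xs → h (suc y ∷ xs) ≡ g (h (y ∷ xs) ∷ y ∷ xs)) →
                Definable (suc n) h
rec-definable {g = g} (p , ⟦p⟧≡f) (q , ⟦q⟧≡g) h h-zero h-suc = R p q , ⟦R⟧≡h
  where
  ⟦R⟧≡h : ∀ xs → ⟦ R p q ⟧ xs ≡ h xs
  ⟦R⟧≡h (zero ∷ xs)  = trans (⟦p⟧≡f xs) (sym (h-zero xs))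
  ⟦R⟧≡h (suc y ∷ xs) = begin
    ⟦ q ⟧ (⟦ R p q ⟧ (y ∷ xs) ∷ y ∷ xs) ≡⟨ ⟦q⟧≡g _ ⟩
    g (⟦ R p q ⟧ (y ∷ xs) ∷ y ∷ xs)     ≡⟨ cong (λ z → g (z ∷ y ∷ xs)) (⟦R⟧≡h (y ∷ xs)) ⟩
    g (h (y ∷ xs) ∷ y ∷ xs)             ≡⟨ sym (h-suc y xs) ⟩
    h (suc y ∷ xs)                      ∎
    where open ≡-Reasoning

+-definable : Definable₂ _+_
+-definable = rec-definable (proj-definable zero)
  (∘₁-definable suc-definable (proj-definable zero)) _ (λ _ → refl) (λ _ _ → refl)

pred-definable : Definable₁ pred
pred-definable = rec-definable (const-definable 0)
  (proj-definable (suc zero)) _ (λ _ → refl) (λ _ _ → refl)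

∸-definable : Definable₂ _∸_
∸-definable = ∘₂-definable flip-∸-definable (proj-definable (suc zero)) (proj-definable zero)
  where
  flip-∸-definable : Definable₂ (flip _∸_)
  flip-∸-definable = rec-definable (proj-definable zero)
    (∘₁-definable pred-definable (proj-definable zero)) _
    (λ _ → refl) (λ y xs → sym (pred[m∸n]≡m∸[1+n] (lookup xs zero) y))

triangle : ℕ → ℕ
triangle zero    = 0
triangle (suc k) = triangle k + suc k

pair : ℕ → ℕ → ℕ
pair a b = triangle (a + b) + a

OnDiagonal : ℕ → ℕ → Set
OnDiagonal k n = triangle k ≤ n × n < triangle (suc k)

-- 1 ∸ (m ∸ n) is the indicator of m ≤ n.
diagonal : ℕ → ℕ
diagonal zero    = 0
diagonal (suc n) = (1 ∸ (triangle (suc (diagonal n)) ∸ suc n)) + diagonal n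

unpair₁ : ℕ → ℕ
unpair₁ n = n ∸ triangle (diagonal n)

unpair₂ : ℕ → ℕ
unpair₂ n = diagonal n ∸ unpair₁ n

1∸[m∸n]≡1 : ∀ {m n} → m ≤ n → 1 ∸ (m ∸ n) ≡ 1
1∸[m∸n]≡1 m≤n = cong (1 ∸_) (m≤n⇒m∸n≡0 m≤n)

1∸[m∸n]≡0 : ∀ {m n} → n < m → 1 ∸ (m ∸ n) ≡ 0
1∸[m∸n]≡0 n<m = m≤n⇒m∸n≡0 (m<n⇒0<n∸m n<m)

onDiagonal-diagonal : ∀ n → OnDiagonal (diagonal n) n
onDiagonal-diagonal zero = z≤n , z<s
onDiagonal-diagonal (suc n)
  with onDiagonal-diagonal n | triangle (suc (diagonal n)) ≤? suc n
... | _ , n<next | yes next≤1+n rewrite 1∸[m∸n]≡1 next≤1+n =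
  next≤1+n , ≤-<-trans n<next (m<m+n _ z<s)
... | lo , _     | no next≰1+n  rewrite 1∸[m∸n]≡0 (≰⇒> next≰1+n) =
  m≤n⇒m≤1+n lo , ≰⇒> next≰1+n

triangle-mono-≤ : ∀ {k j} → k ≤ j → triangle k ≤ triangle j
triangle-mono-≤ z≤n       = z≤n
triangle-mono-≤ (s≤s k≤j) = +-mono-≤ (triangle-mono-≤ k≤j) (s≤s k≤j)

onDiagonal-unique : ∀ {k j n} → OnDiagonal k n → OnDiagonal j n → k ≡ j
onDiagonal-unique {k} {j} (lo₁ , hi₁) (lo₂ , hi₂) with <-cmp k j
... | tri< k<j _ _ = contradiction (≤-trans (triangle-mono-≤ k<j) lo₂) (<⇒≱ hi₁)
... | tri≈ _ k≡j _ = k≡j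
... | tri> _ _ j<k = contradiction (≤-trans (triangle-mono-≤ j<k) lo₁) (<⇒≱ hi₂)

onDiagonal-pair : ∀ a b → OnDiagonal (a + b) (pair a b)
onDiagonal-pair a b = m≤m+n _ a , +-monoʳ-< (triangle (a + b)) (s≤s (m≤m+n a b))

diagonal-pair : ∀ a b → diagonal (pair a b) ≡ a + b
diagonal-pair a b = onDiagonal-unique (onDiagonal-diagonal (pair a b)) (onDiagonal-pair a b)

unpair₁-pair : ∀ a b → unpair₁ (pair a b) ≡ a
unpair₁-pair a b rewrite diagonal-pair a b = m+n∸m≡n (triangle (a + b)) a

unpair₂-pair : ∀ a b → unpair₂ (pair a b) ≡ b
unpair₂-pair a b rewrite unpair₁-pair a b | diagonal-pair a b = m+n∸m≡n a b

pair-unpair : ∀ n → pair (unpair₁ n) (unpair₂ n) ≡ n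
pair-unpair n = begin
  triangle (unpair₁ n + (d ∸ unpair₁ n)) + unpair₁ n
    ≡⟨ cong (λ k → triangle k + unpair₁ n) (m+[n∸m]≡n unpair₁≤d) ⟩
  triangle d + (n ∸ triangle d)
    ≡⟨ m+[n∸m]≡n lo ⟩
  n ∎
  where
  open ≡-Reasoning
  d = diagonal n
  lo : triangle d ≤ n
  lo = proj₁ (onDiagonal-diagonal n)
  unpair₁≤d : unpair₁ n ≤ d
  unpair₁≤d = s≤s⁻¹ (m<n+o⇒m∸n<o n (triangle d) (proj₂ (onDiagonal-diagonal n)))

triangle-definable : Definable₁ triangle
triangle-definable = rec-definable (const-definable 0)
  (∘₂-definable +-definable (proj-definable zero) (∘₁-definable suc-definable (proj-definable (suc zero))))
  _ (λ _ → refl) (λ _ _ → refl)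

diagonal-definable : Definable₁ diagonal
diagonal-definable = rec-definable (const-definable 0)
  (∘₂-definable +-definable
    (∘₂-definable ∸-definable (const-definable 1)
      (∘₂-definable ∸-definable
        (∘₁-definable triangle-definable (∘₁-definable suc-definable (proj-definable zero)))
        (∘₁-definable suc-definable (proj-definable (suc zero)))))
    (proj-definable zero))
  _ (λ _ → refl) (λ _ _ → refl)

pair-definable : Definable₂ pair
pair-definable = ∘₂-definable +-definable
  (∘₁-definable triangle-definable (∘₂-definable +-definable (proj-definable zero) (proj-definable (suc zero))))
  (proj-definable zero)

unpair₁-definable : Definable₁ unpair₁
unpair₁-definable = ∘₂-definable ∸-definable
  (proj-definable zero) (∘₁-definable triangle-definable diagonal-definable)

unpair₂-definable : Definable₁ unpair₂
unpair₂-definable = ∘₂-definable ∸-definable diagonal-definable unpair₁-definable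

! : ∀ X → Hom X 𝟏
! 𝟏 = tt
! 𝐍 = tt

!-unique : ∀ {X} (f g : Hom X 𝟏) → f ≈ g
!-unique {𝟏} _ _ = tt
!-unique {𝐍} _ _ = tt

id : ∀ X → Hom X X
id 𝟏 = tt
id 𝐍 = (λ x → x) , P zero , λ _ → refl

identityˡ : ∀ {X Y} (f : Hom X Y) → (id Y ∘ f) ≈ f
identityˡ {Y = 𝟏} f = !-unique _ f
identityˡ {𝟏} {𝐍} f = refl
identityˡ {𝐍} {𝐍} f = λ _ → refl

≈-sym : ∀ {X Y} {f g : Hom X Y} → f ≈ g → g ≈ f
≈-sym {𝟏} {𝟏} _   = tt
≈-sym {𝟏} {𝐍} f≈g = sym f≈g
≈-sym {𝐍} {𝟏} _   = tt
≈-sym {𝐍} {𝐍} f≈g = λ x → sym (f≈g x)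

≈-trans : ∀ {X Y} {f g h : Hom X Y} → f ≈ g → g ≈ h → f ≈ h
≈-trans {𝟏} {𝟏} _   _   = tt
≈-trans {𝟏} {𝐍} f≈g g≈h = trans f≈g g≈h
≈-trans {𝐍} {𝟏} _   _   = tt
≈-trans {𝐍} {𝐍} f≈g g≈h = λ x → trans (f≈g x) (g≈h x)

assoc : ∀ {A B C D} (h : Hom C D) (g : Hom B C) (f : Hom A B) → ((h ∘ g) ∘ f) ≈ (h ∘ (g ∘ f))
assoc {D = 𝟏} _ _ _ = !-unique _ _
assoc {𝟏} {𝟏} {𝟏} {𝐍} _ _ _ = refl
assoc {𝟏} {𝟏} {𝐍} {𝐍} _ _ _ = refl
assoc {𝟏} {𝐍} {𝟏} {𝐍} _ _ _ = refl
assoc {𝟏} {𝐍} {𝐍} {𝐍} _ _ _ = refl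
assoc {𝐍} {𝟏} {𝟏} {𝐍} _ _ _ = λ _ → refl
assoc {𝐍} {𝟏} {𝐍} {𝐍} _ _ _ = λ _ → refl
assoc {𝐍} {𝐍} {𝟏} {𝐍} _ _ _ = λ _ → refl
assoc {𝐍} {𝐍} {𝐍} {𝐍} _ _ _ = λ _ → refl

∘-resp-≈ʳ : ∀ {A B C} (g : Hom B C) {f f′ : Hom A B} → f ≈ f′ → (g ∘ f) ≈ (g ∘ f′)
∘-resp-≈ʳ {C = 𝟏} _ _ = !-unique _ _
∘-resp-≈ʳ {𝟏} {𝟏} {𝐍} _ _     = refl
∘-resp-≈ʳ {𝟏} {𝐍} {𝐍} g f≈f′ = cong (proj₁ g) f≈f′
∘-resp-≈ʳ {𝐍} {𝟏} {𝐍} _ _     = λ _ → refl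
∘-resp-≈ʳ {𝐍} {𝐍} {𝐍} g f≈f′ = λ x → cong (proj₁ g) (f≈f′ x)

record BinaryProduct (A B : Obj) : Set where
  field
    A×B      : Obj
    π₁       : Hom A×B A
    π₂       : Hom A×B B
    ⟨_,_⟩    : ∀ {X} → Hom X A → Hom X B → Hom X A×B
    project₁ : ∀ {X} (f : Hom X A) (g : Hom X B) → (π₁ ∘ ⟨ f , g ⟩) ≈ f
    project₂ : ∀ {X} (f : Hom X A) (g : Hom X B) → (π₂ ∘ ⟨ f , g ⟩) ≈ g
    unique   : ∀ {X} (f : Hom X A) (g : Hom X B) (h : Hom X A×B) →
               (π₁ ∘ h) ≈ f → (π₂ ∘ h) ≈ g → h ≈ ⟨ f , g ⟩

𝟏×-product : ∀ A → BinaryProduct 𝟏 A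
𝟏×-product A = record
  { A×B      = A
  ; π₁       = ! A
  ; π₂       = id A
  ; ⟨_,_⟩    = λ _ g → g
  ; project₁ = λ _ _ → !-unique _ _
  ; project₂ = λ _ g → identityˡ g
  ; unique   = λ _ _ h _ π₂∘h≈g → ≈-trans (≈-sym (identityˡ h)) π₂∘h≈g
  }

×𝟏-product : ∀ A → BinaryProduct A 𝟏
×𝟏-product A = record
  { A×B      = A
  ; π₁       = id A
  ; π₂       = ! A
  ; ⟨_,_⟩    = λ f _ → f
  ; project₁ = λ f _ → identityˡ f
  ; project₂ = λ _ _ → !-unique _ _
  ; unique   = λ _ _ h π₁∘h≈f _ → ≈-trans (≈-sym (identityˡ h)) π₁∘h≈f
  }

isPrimRec⇒definable : ∀ {f} → IsPrimRec f → Definable₁ f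
isPrimRec⇒definable (p , ⟦p⟧≡f) = p , λ { (x ∷ []) → ⟦p⟧≡f x }

definable⇒hom : ∀ {f} → Definable 1 f → Hom 𝐍 𝐍
definable⇒hom {f} (p , ⟦p⟧≡f) = (λ x → f (x ∷ [])) , p , λ x → ⟦p⟧≡f (x ∷ [])

pairing : ∀ {X} → Hom X 𝐍 → Hom X 𝐍 → Hom X 𝐍
pairing {𝟏} a b = pair a b
pairing {𝐍} (f , f-primRec) (g , g-primRec) =
  definable⇒hom (∘₂-definable pair-definable
    (isPrimRec⇒definable f-primRec) (isPrimRec⇒definable g-primRec))

cantorProduct : BinaryProduct 𝐍 𝐍
cantorProduct = record
  { A×B      = 𝐍
  ; π₁       = π₁
  ; π₂       = π₂
  ; ⟨_,_⟩    = pairing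
  ; project₁ = π₁-pairing
  ; project₂ = π₂-pairing
  ; unique   = pairing-unique
  }
  where
  π₁ π₂ : Hom 𝐍 𝐍
  π₁ = definable⇒hom unpair₁-definable
  π₂ = definable⇒hom unpair₂-definable

  π₁-pairing : ∀ {X} (f g : Hom X 𝐍) → (π₁ ∘ pairing f g) ≈ f
  π₁-pairing {𝟏} a b   = unpair₁-pair a b
  π₁-pairing {𝐍} f g x = unpair₁-pair (proj₁ f x) (proj₁ g x)

  π₂-pairing : ∀ {X} (f g : Hom X 𝐍) → (π₂ ∘ pairing f g) ≈ g
  π₂-pairing {𝟏} a b   = unpair₂-pair a b
  π₂-pairing {𝐍} f g x = unpair₂-pair (proj₁ f x) (proj₁ g x)

  pairing-unique : ∀ {X} (f g h : Hom X 𝐍) → (π₁ ∘ h) ≈ f → (π₂ ∘ h) ≈ g → h ≈ pairing f g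
  pairing-unique {𝟏} a b c π₁c≡a π₂c≡b =
    trans (sym (pair-unpair c)) (cong₂ pair π₁c≡a π₂c≡b)
  pairing-unique {𝐍} f g h π₁∘h≈f π₂∘h≈g x =
    trans (sym (pair-unpair (proj₁ h x))) (cong₂ pair (π₁∘h≈f x) (π₂∘h≈g x))

binaryProduct : ∀ A B → BinaryProduct A B
binaryProduct 𝟏 B = 𝟏×-product B
binaryProduct 𝐍 𝟏 = ×𝟏-product 𝐍
binaryProduct 𝐍 𝐍 = cantorProduct

emptyProduct : (o : Fin 0 → Obj) → Limit (discrete 0 o)
emptyProduct o = record
  { apex    = 𝟏
  ; cone    = record { leg = λ () ; commute = λ () }
  ; mediate = λ {X} _ → ! X
  ; factor  = λ _ ()
  ; unique  = λ _ _ _ → !-unique _ _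
  }

consProduct : ∀ {n} (o : Fin (suc n) → Obj) (L : Limit (discrete n (λ i → o (suc i)))) →
              BinaryProduct (o zero) (Limit.apex L) → Limit (discrete (suc n) o)
consProduct {n} o L product = record
  { apex    = A×B
  ; cone    = record { leg = leg ; commute = λ () }
  ; mediate = mediate
  ; factor  = factor
  ; unique  = mediate-unique
  }
  where
  open BinaryProduct product
  module L = Limit L

  leg : (v : Fin (suc n)) → Hom A×B (o v)
  leg zero    = π₁
  leg (suc i) = Cone.leg L.cone i ∘ π₂

  tail : ∀ {X} → Cone (discrete (suc n) o) X → Cone (discrete n (λ i → o (suc i))) X
  tail K = record { leg = λ i → Cone.leg K (suc i) ; commute = λ () }

  mediate : ∀ {X} → Cone (discrete (suc n) o) X → Hom X A×B
  mediate K = ⟨ Cone.leg K zero , L.mediate (tail K) ⟩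

  factor : ∀ {X} (K : Cone (discrete (suc n) o) X) (v : Fin (suc n)) →
           (leg v ∘ mediate K) ≈ Cone.leg K v
  factor K zero    = project₁ _ _
  factor K (suc i) =
    ≈-trans (assoc (Cone.leg L.cone i) π₂ (mediate K))
      (≈-trans (∘-resp-≈ʳ (Cone.leg L.cone i) (project₂ _ _)) (L.factor (tail K) i))

  mediate-unique : ∀ {X} (K : Cone (discrete (suc n) o) X) (u : Hom X A×B) →
            (∀ v → (leg v ∘ u) ≈ Cone.leg K v) → u ≈ mediate K
  mediate-unique K u u-factors = unique _ _ u (u-factors zero)
    (L.unique (tail K) (π₂ ∘ u) λ i →
      ≈-trans (≈-sym (assoc (Cone.leg L.cone i) π₂ u)) (u-factors (suc i)))

finiteProducts : HasFiniteProducts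
finiteProducts zero    o = emptyProduct o
finiteProducts (suc n) o = consProduct o L (binaryProduct (o zero) (Limit.apex L))
  where
  L : Limit (discrete n (λ i → o (suc i)))
  L = finiteProducts n (λ i → o (suc i))

sucLoop : FinDiagram
sucLoop = record
  { nV  = 1
  ; nE  = 1
  ; src = λ _ → zero
  ; tgt = λ _ → zero
  ; obj = λ _ → 𝐍
  ; mor = λ _ → suc , S , λ _ → refl
  }

sucLoop-noCone : ∀ {X} → ¬ Cone sucLoop X
sucLoop-noCone {𝟏} K = 1+n≢n (Cone.commute K zero)
sucLoop-noCone {𝐍} K = 1+n≢n (Cone.commute K zero 0)

mainTheorem7 : HasFiniteProducts × ¬ HasFiniteLimits
mainTheorem7 = finiteProducts , λ hasLimits → sucLoop-noCone (Limit.cone (hasLimits sucLoop))
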